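{- Let $b\ge 1$ and let $r=(r_1,\ldots,r_\ell)$ be an ordered partition of $b$. Then the total number of embeddings (trivial and nontrivial) of ordered partitions of $b$ into $r$, i.e. the column sum $\sum_{q} (A_b)_{q,r}$ over all ordered partitions $q$ of $b$, equals \[ \prod_{i=1}^{\ell}(r_i+1). \]
   Context: An ordered partition (composition) of a positive integer $b$ is a finite sequence $(q_1,\ldots,q_k)$ of positive integers with $q_1+\cdots+q_k=b$. For ordered partitions $q=(q_1,\ldots,q_k)$ and $r=(r_1,\ldots,r_\ell)$ of $b$, a nontrivial embedding of $q$ into $r$ is a choice of indices $1\le i_2<i_3<\cdots<i_k\le \ell$ with $q_j\le r_{i_j}$ for all $2\le j\le k$ (distinct index choices are distinct embeddings; when $k=1$ there is exactly one, the empty choice). In addition, $q$ has exactly one trivial embedding into $r$ if $q=r$ and none otherwise. $A_b$ is the matrix with rows and columns indexed by the ordered partitions of $b$ whose $(q,r)$ entry is the number of nontrivial embeddings of $q$ into $r$ plus $1$ if $q=r$ (and plus $0$ otherwise). (Each embedding corresponds to a juggling "card" with $q$ on its left and $r$ on its right.) -}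

module Defs where

open import Data.Nat using (ℕ; zero; suc; _+_; _≤_; _≤?_)
open import Data.Nat.Properties using (_≟_)
open import Data.List using (List; []; _∷_; map; concatMap; filter; upTo; applyUpTo)
open import Data.Nat.ListAction using (sum)
open import Data.List.Properties using (≡-dec)
open import Data.List.Relation.Unary.All using (All)
open import Data.Product using (_×_)
open import Relation.Nullary.Decidable using (does)
open import Relation.Binary.PropositionalEquality using (_≡_)
open import Data.Bool using (if_then_else_)

IsComposition : ℕ → List ℕ → Set
IsComposition b q = All (λ x → 1 ≤ x) q × sum q ≡ b

listsOfLen : ℕ → ℕ → List (List ℕ)
listsOfLen b zero = [] ∷ []
listsOfLen b (suc k) =
  concatMap (λ x → map (x ∷_) (listsOfLen b k)) (applyUpTo suc b)

compositions : ℕ → List (List ℕ)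
compositions b =
  filter (λ q → sum q ≟ b) (concatMap (listsOfLen b) (upTo (suc b)))

-- Number of choices of indices i₁ < … < i_m in r with qs_j ≤ r_{i_j}.
dominatedSubseqs : List ℕ → List ℕ → ℕ
dominatedSubseqs [] rs = 1
dominatedSubseqs (q ∷ qs) [] = 0
dominatedSubseqs (q ∷ qs) (r ∷ rs) =
  (if does (q ≤? r) then dominatedSubseqs qs rs else 0) + dominatedSubseqs (q ∷ qs) rs

-- Number of nontrivial embeddings of q = (q₁,…,q_k) into r:
-- index choices i₂ < … < i_k with q_j ≤ r_{i_j} (q₁ is ignored).
nontrivialEmbeddings : List ℕ → List ℕ → ℕ
nontrivialEmbeddings [] r = 0   -- never used: compositions of b ≥ 1 are nonempty
nontrivialEmbeddings (q₁ ∷ qs) r = dominatedSubseqs qs r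

A : List ℕ → List ℕ → ℕ
A q r = nontrivialEmbeddings q r + (if does (≡-dec _≟_ q r) then 1 else 0)

-- Split each composition q = (q₁, t) of b into its tail t, a word with letters in {1,…,b},
-- and its head q₁ = b − Σt, which exists iff Σt < b.  Summed over all words t of length k,
-- the number of dominated subsequence embeddings of t into r is the elementary symmetric
-- function e_k(r), since r_i ≤ b admits exactly r_i letters below it; and Σₖ e_k(r) = ∏(1 + r_i).
-- The condition Σt < b discards exactly the words with Σt ≥ Σr, and such a word embeds into r
-- only if t = r, and then just once.  That lost 1 is restored by the trivial embedding of r.

module Submission where

open import Defs
open import Data.Bool.Base using (true; false; if_then_else_)
open import Data.List.Base
  using (List; []; _∷_; _++_; map; filter; concatMap; applyUpTo; upTo; length)
open import Data.List.Properties
  using (≡-dec; ∷-injectiveˡ; ∷-injectiveʳ; map-++; map-∘; map-applyUpTo; map-upTo; upTo-∷ʳ)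
open import Data.List.Relation.Unary.All as All using (All; []; _∷_)
open import Data.Nat.Base
open import Data.Nat.ListAction using (sum; product)
open import Data.Nat.ListAction.Properties using (sum-++)
open import Data.Nat.Properties
open import Algebra.Properties.CommutativeSemigroup +-commutativeSemigroup
  using (interchange; xy∙z≈xz∙y)
open import Data.Product.Base using (_,_)
open import Function.Base using (_∘_)
open import Relation.Nullary.Decidable using (Dec; yes; no; does; _×-dec_)
open import Relation.Nullary.Negation using (¬_; contradiction)
open import Relation.Unary using (Decidable)
open import Relation.Binary.PropositionalEquality
open ≡-Reasoning

private variable
  P Q X Y : Set

χ : Dec P → ℕ
χ d = if does d then 1 else 0

if-yes : (d : Dec P) {a : ℕ} → P → (if does d then a else 0) ≡ a
if-yes (yes _) _ = refl
if-yes (no ¬p) p = contradiction p ¬p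

if-no : (d : Dec P) {a : ℕ} → ¬ P → (if does d then a else 0) ≡ 0
if-no (yes p) ¬p = contradiction p ¬p
if-no (no _)  _  = refl

χ-cong : (P → Q) → (Q → P) → (d : Dec P) (e : Dec Q) → χ d ≡ χ e
χ-cong P⇒Q Q⇒P (yes p) e = sym (if-yes e (P⇒Q p))
χ-cong P⇒Q Q⇒P (no ¬p) e = sym (if-no e (¬p ∘ Q⇒P))

χ-×-dec : (d : Dec P) (e : Dec Q) → χ (d ×-dec e) ≡ χ d * χ e
χ-×-dec (yes _) e = sym (+-identityʳ (χ e))
χ-×-dec (no _)  e = refl

χ-*-implied : (Q → P) → (d : Dec P) (e : Dec Q) → χ d * χ e ≡ χ e
χ-*-implied Q⇒P d (yes q) = cong (_* 1) (if-yes d (Q⇒P q))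
χ-*-implied Q⇒P d (no _)  = *-zeroʳ (χ d)

if-then-0≡χ* : (d : Dec P) (a : ℕ) → (if does d then a else 0) ≡ χ d * a
if-then-0≡χ* (yes _) a = sym (+-identityʳ a)
if-then-0≡χ* (no _)  a = refl

_≡?_ : (t r : List ℕ) → Dec (t ≡ r)
_≡?_ = ≡-dec _≟_

∑ : List X → (X → ℕ) → ℕ
∑ xs f = sum (map f xs)

infixr 6.5 ∑ ∑<
syntax ∑ xs (λ x → e) = ∑[ x ∈ xs ] e

∑< : ℕ → (ℕ → ℕ) → ℕ
∑< n f = ∑ (upTo n) f

syntax ∑< n (λ i → e) = ∑[ i < n ] e

∑-cong : {f g : X → ℕ} → (∀ x → f x ≡ g x) → ∀ xs → ∑ xs f ≡ ∑ xs g
∑-cong f≗g []       = refl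
∑-cong f≗g (x ∷ xs) = cong₂ _+_ (f≗g x) (∑-cong f≗g xs)

∑-zero : {f : X → ℕ} → (∀ x → f x ≡ 0) → ∀ xs → ∑ xs f ≡ 0
∑-zero f≗0 []       = refl
∑-zero f≗0 (x ∷ xs) = cong₂ _+_ (f≗0 x) (∑-zero f≗0 xs)

∑-distrib-+ : ∀ (f g : X → ℕ) xs → ∑[ x ∈ xs ] (f x + g x) ≡ ∑ xs f + ∑ xs g
∑-distrib-+ f g []       = refl
∑-distrib-+ f g (x ∷ xs) = begin
  (f x + g x) + ∑[ y ∈ xs ] (f y + g y)
    ≡⟨ cong (f x + g x +_) (∑-distrib-+ f g xs) ⟩
  (f x + g x) + (∑ xs f + ∑ xs g)
    ≡⟨ interchange (f x) (g x) (∑ xs f) (∑ xs g) ⟩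
  (f x + ∑ xs f) + (g x + ∑ xs g) ∎

∑-distribˡ-* : ∀ c (f : X → ℕ) xs → ∑[ x ∈ xs ] (c * f x) ≡ c * ∑ xs f
∑-distribˡ-* c f []       = sym (*-zeroʳ c)
∑-distribˡ-* c f (x ∷ xs) =
  trans (cong (c * f x +_) (∑-distribˡ-* c f xs)) (sym (*-distribˡ-+ c (f x) (∑ xs f)))

∑-distribʳ-* : ∀ c (f : X → ℕ) xs → ∑[ x ∈ xs ] (f x * c) ≡ ∑ xs f * c
∑-distribʳ-* c f xs = begin
  ∑[ x ∈ xs ] (f x * c) ≡⟨ ∑-cong (λ x → *-comm (f x) c) xs ⟩
  ∑[ x ∈ xs ] (c * f x) ≡⟨ ∑-distribˡ-* c f xs ⟩
  c * ∑ xs f            ≡⟨ *-comm c (∑ xs f) ⟩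
  ∑ xs f * c            ∎

∑-++ : ∀ (f : X → ℕ) xs ys → ∑ (xs ++ ys) f ≡ ∑ xs f + ∑ ys f
∑-++ f xs ys = trans (cong sum (map-++ f xs ys)) (sum-++ (map f xs) (map f ys))

∑-map : (f : X → ℕ) (g : Y → X) → ∀ xs → ∑ (map g xs) f ≡ ∑[ y ∈ xs ] f (g y)
∑-map f g xs = cong sum (sym (map-∘ xs))

∑-concatMap : (f : X → ℕ) (g : Y → List X) → ∀ xs →
              ∑ (concatMap g xs) f ≡ ∑[ y ∈ xs ] ∑ (g y) f
∑-concatMap f g []       = refl
∑-concatMap f g (y ∷ ys) =
  trans (∑-++ f (g y) (concatMap g ys)) (cong (∑ (g y) f +_) (∑-concatMap f g ys))

∑-filter : {P : X → Set} (P? : Decidable P) (f : X → ℕ) → ∀ xs →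
           ∑ (filter P? xs) f ≡ ∑[ x ∈ xs ] χ (P? x) * f x
∑-filter P? f []       = refl
∑-filter P? f (x ∷ xs) with does (P? x)
... | true  = cong₂ _+_ (sym (*-identityˡ (f x))) (∑-filter P? f xs)
... | false = ∑-filter P? f xs

∑-comm : (F : X → Y → ℕ) → ∀ xs ys →
         ∑[ x ∈ xs ] ∑[ y ∈ ys ] F x y ≡ ∑[ y ∈ ys ] ∑[ x ∈ xs ] F x y
∑-comm F []       ys = sym (∑-zero (λ _ → refl) ys)
∑-comm F (x ∷ xs) ys = begin
  ∑[ y ∈ ys ] F x y + ∑[ x′ ∈ xs ] ∑[ y ∈ ys ] F x′ y
    ≡⟨ cong (∑[ y ∈ ys ] F x y +_) (∑-comm F xs ys) ⟩
  ∑[ y ∈ ys ] F x y + ∑[ y ∈ ys ] ∑[ x′ ∈ xs ] F x′ y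
    ≡⟨ ∑-distrib-+ (F x) (λ y → ∑[ x′ ∈ xs ] F x′ y) ys ⟨
  ∑[ y ∈ ys ] (F x y + ∑[ x′ ∈ xs ] F x′ y) ∎

∑-applyUpTo : (f : X → ℕ) (g : ℕ → X) → ∀ n → ∑ (applyUpTo g n) f ≡ ∑[ i < n ] f (g i)
∑-applyUpTo f g n = cong sum (trans (map-applyUpTo g f n) (sym (map-upTo (f ∘ g) n)))

∑<-suc : ∀ n (f : ℕ → ℕ) → ∑[ i < suc n ] f i ≡ f 0 + ∑[ i < n ] f (suc i)
∑<-suc n f = cong (f 0 +_) (∑-applyUpTo f suc n)

∑<-sucʳ : ∀ n (f : ℕ → ℕ) → ∑[ i < suc n ] f i ≡ ∑[ i < n ] f i + f n
∑<-sucʳ n f = begin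
  ∑ (upTo (suc n)) f        ≡⟨ cong (λ is → ∑ is f) (upTo-∷ʳ n) ⟨
  ∑ (upTo n ++ n ∷ []) f    ≡⟨ ∑-++ f (upTo n) (n ∷ []) ⟩
  ∑ (upTo n) f + (f n + 0)  ≡⟨ cong (∑ (upTo n) f +_) (+-identityʳ (f n)) ⟩
  ∑ (upTo n) f + f n        ∎

∑-sift : ∀ {x n} (g : ℕ → ℕ) → x < n → ∑[ i < n ] χ (i ≟ x) * g i ≡ g x
∑-sift {zero}  {suc n} g _ = begin
  ∑[ i < suc n ] χ (i ≟ 0) * g i
    ≡⟨ ∑<-suc n (λ i → χ (i ≟ 0) * g i) ⟩
  (g 0 + 0) + ∑[ i < n ] 0
    ≡⟨ cong₂ _+_ (+-identityʳ (g 0)) (∑-zero (λ _ → refl) (upTo n)) ⟩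
  g 0 + 0
    ≡⟨ +-identityʳ (g 0) ⟩
  g 0 ∎
∑-sift {suc x} {suc n} g (s≤s x<n) =
  trans (∑<-suc n (λ i → χ (i ≟ suc x) * g i)) (∑-sift (g ∘ suc) x<n)

∑-χ≟ : ∀ {x n} → x < n → ∑[ i < n ] χ (i ≟ x) ≡ 1
∑-χ≟ {x} {n} x<n =
  trans (∑-cong (λ i → sym (*-identityʳ (χ (i ≟ x)))) (upTo n)) (∑-sift (λ _ → 1) x<n)

∑-χ<? : ∀ {y n} → y ≤ n → ∑[ i < n ] χ (i <? y) ≡ y
∑-χ<? {zero}  {n}     _         = ∑-zero (λ _ → refl) (upTo n)
∑-χ<? {suc y} {suc n} (s≤s y≤n) =
  trans (∑<-suc n (λ i → χ (i <? suc y))) (cong suc (∑-χ<? y≤n))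

All-≤-sum : ∀ v → All (_≤ sum v) v
All-≤-sum []       = []
All-≤-sum (y ∷ ys) =
  m≤m+n y (sum ys) ∷ All.map (λ y′≤ → ≤-trans y′≤ (m≤n+m (sum ys) y)) (All-≤-sum ys)

length≤sum : ∀ {v} → All (1 ≤_) v → length v ≤ sum v
length≤sum []         = z≤n
length≤sum (y>0 ∷ ys) = +-mono-≤ y>0 (length≤sum ys)

sum<⇒dominatedSubseqs≡0 : ∀ t r → sum r < sum t → dominatedSubseqs t r ≡ 0
sum<⇒dominatedSubseqs≡0 (q ∷ qs) []       _ = refl
sum<⇒dominatedSubseqs≡0 (q ∷ qs) (y ∷ ys) r<t with q ≤? y
... | yes q≤y = cong₂ _+_ (trans (if-yes (q ≤? y) q≤y) (sum<⇒dominatedSubseqs≡0 qs ys ys<qs))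
                          (sum<⇒dominatedSubseqs≡0 (q ∷ qs) ys ys<t)
  where
  ys<t : sum ys < q + sum qs
  ys<t = ≤-<-trans (m≤n+m (sum ys) y) r<t
  ys<qs : sum ys < sum qs
  ys<qs = +-cancelˡ-< q (sum ys) (sum qs) (≤-<-trans (+-monoˡ-≤ (sum ys) q≤y) r<t)
... | no  q≰y = cong₂ _+_ (if-no (q ≤? y) q≰y)
                          (sum<⇒dominatedSubseqs≡0 (q ∷ qs) ys (≤-<-trans (m≤n+m (sum ys) y) r<t))

sum≤⇒dominatedSubseqs≡χ : ∀ t r → All (1 ≤_) r → sum r ≤ sum t →
                          dominatedSubseqs t r ≡ χ (t ≡? r)
sum≤⇒dominatedSubseqs≡χ []       []       _          _   = refl
sum≤⇒dominatedSubseqs≡χ []       (y ∷ ys) (y>0 ∷ _)  r≤0 =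
  contradiction (≤-trans y>0 (≤-trans (m≤m+n y (sum ys)) r≤0)) λ ()
sum≤⇒dominatedSubseqs≡χ (q ∷ qs) []       _          _   = refl
sum≤⇒dominatedSubseqs≡χ (q ∷ qs) (y ∷ ys) (y>0 ∷ ys>0) r≤t with q ≤? y
... | yes q≤y = begin
  dominatedSubseqs (q ∷ qs) (y ∷ ys)
    ≡⟨ cong₂ _+_ (trans (if-yes (q ≤? y) q≤y) (sum≤⇒dominatedSubseqs≡χ qs ys ys>0 ys≤qs))
                 (sum<⇒dominatedSubseqs≡0 (q ∷ qs) ys ys<t) ⟩
  χ (qs ≡? ys) + 0
    ≡⟨ +-identityʳ _ ⟩
  χ (qs ≡? ys)
    ≡⟨ χ-cong (λ qs≡ys → cong₂ _∷_ (q≡y qs≡ys) qs≡ys) ∷-injectiveʳ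
              (qs ≡? ys) ((q ∷ qs) ≡? (y ∷ ys)) ⟩
  χ ((q ∷ qs) ≡? (y ∷ ys)) ∎
  where
  ys<t : sum ys < q + sum qs
  ys<t = <-≤-trans (m<n+m (sum ys) y>0) r≤t
  ys≤qs : sum ys ≤ sum qs
  ys≤qs = +-cancelˡ-≤ q (sum ys) (sum qs) (≤-trans (+-monoˡ-≤ (sum ys) q≤y) r≤t)
  q≡y : qs ≡ ys → q ≡ y
  q≡y refl = ≤-antisym q≤y (+-cancelʳ-≤ (sum qs) y q r≤t)
... | no  q≰y = begin
  dominatedSubseqs (q ∷ qs) (y ∷ ys)
    ≡⟨ cong₂ _+_ (if-no (q ≤? y) q≰y) (sum<⇒dominatedSubseqs≡0 (q ∷ qs) ys ys<t) ⟩
  0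
    ≡⟨ if-no ((q ∷ qs) ≡? (y ∷ ys)) (q≰y ∘ ≤-reflexive ∘ ∷-injectiveˡ) ⟨
  χ ((q ∷ qs) ≡? (y ∷ ys)) ∎
  where
  ys<t : sum ys < q + sum qs
  ys<t = <-≤-trans (m<n+m (sum ys) y>0) r≤t

dominatedSubseqs-split : ∀ t r → All (1 ≤_) r →
  χ (sum t <? sum r) * dominatedSubseqs t r + χ (t ≡? r) ≡ dominatedSubseqs t r
dominatedSubseqs-split t r r>0 = split (sum t <? sum r)
  where
  split : (t<r? : Dec (sum t < sum r)) →
          χ t<r? * dominatedSubseqs t r + χ (t ≡? r) ≡ dominatedSubseqs t r
  split (yes t<r) = trans (cong₂ _+_ (*-identityˡ _) (if-no (t ≡? r) λ { refl → <-irrefl refl t<r }))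
                          (+-identityʳ (dominatedSubseqs t r))
  split (no  t≮r) = sym (sum≤⇒dominatedSubseqs≡χ t r r>0 (≮⇒≥ t≮r))

esym : ℕ → List ℕ → ℕ
esym zero    _        = 1
esym (suc k) []       = 0
esym (suc k) (y ∷ ys) = y * esym k ys + esym (suc k) ys

∑-esym : ∀ r n → length r ≤ n → ∑[ k < suc n ] esym k r ≡ product (map suc r)
∑-esym []       n       _         =
  trans (∑<-suc n (λ k → esym k [])) (cong suc (∑-zero (λ _ → refl) (upTo n)))
∑-esym (y ∷ ys) (suc n) (s≤s ys≤n) = begin
  ∑[ k < suc (suc n) ] esym k (y ∷ ys)
    ≡⟨ ∑<-suc (suc n) (λ k → esym k (y ∷ ys)) ⟩
  suc (∑[ k < suc n ] (y * esym k ys + esym (suc k) ys))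
    ≡⟨ cong suc (∑-distrib-+ (λ k → y * esym k ys) (λ k → esym (suc k) ys) (upTo (suc n))) ⟩
  suc (∑[ k < suc n ] y * esym k ys + E⁺)
    ≡⟨ cong (λ e → suc (e + E⁺)) (∑-distribˡ-* y (λ k → esym k ys) (upTo (suc n))) ⟩
  suc (y * (∑[ k < suc n ] esym k ys) + E⁺)
    ≡⟨ cong (λ e → suc (y * e + E⁺)) (∑-esym ys n ys≤n) ⟩
  suc (y * Π + E⁺)
    ≡⟨ +-suc (y * Π) E⁺ ⟨
  y * Π + suc E⁺
    ≡⟨ cong (y * Π +_) 1+E⁺≡Π ⟩
  y * Π + Π
    ≡⟨ +-comm (y * Π) Π ⟩
  suc y * Π ∎
  where
  Π E⁺ : ℕ
  Π  = product (map suc ys)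
  E⁺ = ∑[ k < suc n ] esym (suc k) ys
  1+E⁺≡Π : suc E⁺ ≡ Π
  1+E⁺≡Π = trans (sym (∑<-suc (suc n) (λ k → esym k ys))) (∑-esym ys (suc n) (m≤n⇒m≤1+n ys≤n))

module _ (b : ℕ) where

  ∑-listsOfLen-suc : ∀ k (f : List ℕ → ℕ) →
    ∑ (listsOfLen b (suc k)) f ≡ ∑[ h < b ] ∑[ t ∈ listsOfLen b k ] f (suc h ∷ t)
  ∑-listsOfLen-suc k f = begin
    ∑ (listsOfLen b (suc k)) f
      ≡⟨ ∑-concatMap f (λ x → map (x ∷_) (listsOfLen b k)) (applyUpTo suc b) ⟩
    ∑[ x ∈ applyUpTo suc b ] ∑ (map (x ∷_) (listsOfLen b k)) f
      ≡⟨ ∑-cong (λ x → ∑-map f (x ∷_) (listsOfLen b k)) (applyUpTo suc b) ⟩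
    ∑[ x ∈ applyUpTo suc b ] ∑[ t ∈ listsOfLen b k ] f (x ∷ t)
      ≡⟨ ∑-applyUpTo (λ x → ∑[ t ∈ listsOfLen b k ] f (x ∷ t)) suc b ⟩
    ∑[ h < b ] ∑[ t ∈ listsOfLen b k ] f (suc h ∷ t) ∎

  ∑-listsOfLen-dominatedSubseqs : ∀ k r → All (_≤ b) r →
    ∑[ t ∈ listsOfLen b k ] dominatedSubseqs t r ≡ esym k r
  ∑-listsOfLen-dominatedSubseqs zero    r        _ = refl
  ∑-listsOfLen-dominatedSubseqs (suc k) []       _ =
    trans (∑-listsOfLen-suc k (λ t → dominatedSubseqs t []))
          (∑-zero (λ h → ∑-zero (λ _ → refl) (listsOfLen b k)) (upTo b))
  ∑-listsOfLen-dominatedSubseqs (suc k) (y ∷ ys) (y≤b ∷ ys≤b) = begin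
    ∑[ t ∈ listsOfLen b (suc k) ] dominatedSubseqs t (y ∷ ys)
      ≡⟨ ∑-listsOfLen-suc k (λ t → dominatedSubseqs t (y ∷ ys)) ⟩
    ∑[ h < b ] ∑[ t ∈ listsOfLen b k ] dominatedSubseqs (suc h ∷ t) (y ∷ ys)
      ≡⟨ ∑-cong split-head (upTo b) ⟩
    ∑[ h < b ] (χ (h <? y) * esym k ys + skip-y h)
      ≡⟨ ∑-distrib-+ (λ h → χ (h <? y) * esym k ys) skip-y (upTo b) ⟩
    ∑[ h < b ] χ (h <? y) * esym k ys + ∑[ h < b ] skip-y h
      ≡⟨ cong₂ _+_ (∑-distribʳ-* (esym k ys) (λ h → χ (h <? y)) (upTo b))
                   (sym (∑-listsOfLen-suc k (λ t → dominatedSubseqs t ys))) ⟩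
    (∑[ h < b ] χ (h <? y)) * esym k ys + ∑[ t ∈ listsOfLen b (suc k) ] dominatedSubseqs t ys
      ≡⟨ cong₂ (λ e e′ → e * esym k ys + e′) (∑-χ<? y≤b) (∑-listsOfLen-dominatedSubseqs (suc k) ys ys≤b) ⟩
    esym (suc k) (y ∷ ys) ∎
    where
    skip-y : ℕ → ℕ
    skip-y h = ∑[ t ∈ listsOfLen b k ] dominatedSubseqs (suc h ∷ t) ys
    split-head : ∀ h → ∑[ t ∈ listsOfLen b k ] dominatedSubseqs (suc h ∷ t) (y ∷ ys)
                     ≡ χ (h <? y) * esym k ys + skip-y h
    split-head h = begin
      ∑[ t ∈ listsOfLen b k ] dominatedSubseqs (suc h ∷ t) (y ∷ ys)
        ≡⟨ ∑-distrib-+ _ _ (listsOfLen b k) ⟩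
      ∑[ t ∈ listsOfLen b k ] (if does (suc h ≤? y) then dominatedSubseqs t ys else 0) + skip-y h
        ≡⟨ cong (_+ skip-y h) (∑-cong (λ t → if-then-0≡χ* (suc h ≤? y) _) (listsOfLen b k)) ⟩
      ∑[ t ∈ listsOfLen b k ] χ (h <? y) * dominatedSubseqs t ys + skip-y h
        ≡⟨ cong (_+ skip-y h) (∑-distribˡ-* (χ (h <? y)) (λ t → dominatedSubseqs t ys) (listsOfLen b k)) ⟩
      χ (h <? y) * (∑[ t ∈ listsOfLen b k ] dominatedSubseqs t ys) + skip-y h
        ≡⟨ cong (λ e → χ (h <? y) * e + skip-y h) (∑-listsOfLen-dominatedSubseqs k ys ys≤b) ⟩
      χ (h <? y) * esym k ys + skip-y h ∎

  ∑-listsOfLen-χ≡ : ∀ k v → All (1 ≤_) v → All (_≤ b) v →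
    ∑[ t ∈ listsOfLen b k ] χ (t ≡? v) ≡ χ (k ≟ length v)
  ∑-listsOfLen-χ≡ zero    []       _ _ = refl
  ∑-listsOfLen-χ≡ zero    (_ ∷ _)  _ _ = refl
  ∑-listsOfLen-χ≡ (suc k) []       _ _ =
    trans (∑-listsOfLen-suc k (λ t → χ (t ≡? [])))
          (∑-zero (λ h → ∑-zero (λ _ → refl) (listsOfLen b k)) (upTo b))
  ∑-listsOfLen-χ≡ (suc k) (suc x ∷ v) (_ ∷ v>0) (x<b ∷ v≤b) = begin
    ∑[ t ∈ listsOfLen b (suc k) ] χ (t ≡? (suc x ∷ v))
      ≡⟨ ∑-listsOfLen-suc k (λ t → χ (t ≡? (suc x ∷ v))) ⟩
    ∑[ h < b ] ∑[ t ∈ listsOfLen b k ] χ ((suc h ∷ t) ≡? (suc x ∷ v))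
      ≡⟨ ∑-cong (λ h → ∑-cong (λ t → χ-×-dec (h ≟ x) (t ≡? v)) (listsOfLen b k)) (upTo b) ⟩
    ∑[ h < b ] ∑[ t ∈ listsOfLen b k ] χ (h ≟ x) * χ (t ≡? v)
      ≡⟨ ∑-cong (λ h → ∑-distribˡ-* (χ (h ≟ x)) (λ t → χ (t ≡? v)) (listsOfLen b k)) (upTo b) ⟩
    ∑[ h < b ] χ (h ≟ x) * (∑[ t ∈ listsOfLen b k ] χ (t ≡? v))
      ≡⟨ ∑-sift (λ _ → ∑[ t ∈ listsOfLen b k ] χ (t ≡? v)) x<b ⟩
    ∑[ t ∈ listsOfLen b k ] χ (t ≡? v)
      ≡⟨ ∑-listsOfLen-χ≡ k v v>0 v≤b ⟩
    χ (k ≟ length v) ∎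

  ∑-listsOfLen-sum<≡0 : ∀ k n m (g : List ℕ → ℕ) → m ≤ n + k →
    ∑[ t ∈ listsOfLen b k ] χ (n + sum t <? m) * g t ≡ 0
  ∑-listsOfLen-sum<≡0 zero    n m g m≤n+0 =
    trans (+-identityʳ _) (cong (_* g []) (if-no (n + 0 <? m) (≤⇒≯ m≤n+0)))
  ∑-listsOfLen-sum<≡0 (suc k) n m g m≤n+1+k = begin
    ∑[ t ∈ listsOfLen b (suc k) ] χ (n + sum t <? m) * g t
      ≡⟨ ∑-listsOfLen-suc k (λ t → χ (n + sum t <? m) * g t) ⟩
    ∑[ h < b ] ∑[ t ∈ listsOfLen b k ] χ (n + (suc h + sum t) <? m) * g (suc h ∷ t)
      ≡⟨ ∑-zero shift-head (upTo b) ⟩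
    0 ∎
    where
    shift-head : ∀ h → ∑[ t ∈ listsOfLen b k ] χ (n + (suc h + sum t) <? m) * g (suc h ∷ t) ≡ 0
    shift-head h = begin
      ∑[ t ∈ listsOfLen b k ] χ (n + (suc h + sum t) <? m) * g (suc h ∷ t)
        ≡⟨ ∑-cong (λ t → cong (λ s → χ (s <? m) * g (suc h ∷ t)) (+-assoc n (suc h) (sum t)))
                  (listsOfLen b k) ⟨
      ∑[ t ∈ listsOfLen b k ] χ (n + suc h + sum t <? m) * g (suc h ∷ t)
        ≡⟨ ∑-listsOfLen-sum<≡0 k (n + suc h) m (λ t → g (suc h ∷ t)) m≤n+1+h+k ⟩
      0 ∎
      where
      m≤n+1+h+k : m ≤ n + suc h + k
      m≤n+1+h+k = ≤-trans m≤n+1+k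
        (≤-trans (+-monoʳ-≤ n (s≤s (m≤n+m k h))) (≤-reflexive (sym (+-assoc n (suc h) k))))

∑-sift₁ : ∀ {y n} (g : ℕ → ℕ) → 0 < y → y ≤ n → ∑[ i < n ] χ (suc i ≟ y) * g (suc i) ≡ g y
∑-sift₁ {suc x} g _ x<n = ∑-sift (g ∘ suc) x<n

∑-χ-head : ∀ b s (g : ℕ → ℕ) →
           ∑[ h < b ] χ (suc h + s ≟ b) * g (suc h) ≡ χ (s <? b) * g (b ∸ s)
∑-χ-head b s g = by-cases (s <? b)
  where
  by-cases : (s<b? : Dec (s < b)) →
             ∑[ h < b ] χ (suc h + s ≟ b) * g (suc h) ≡ χ s<b? * g (b ∸ s)
  by-cases (yes s<b) = begin
    ∑[ h < b ] χ (suc h + s ≟ b) * g (suc h)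
      ≡⟨ ∑-cong (λ h → cong (_* g (suc h)) (χ-cong (head≡ h) (sum≡ h) (suc h + s ≟ b) (suc h ≟ b ∸ s)))
                (upTo b) ⟩
    ∑[ h < b ] χ (suc h ≟ b ∸ s) * g (suc h)
      ≡⟨ ∑-sift₁ g (m<n⇒0<n∸m s<b) (m∸n≤m b s) ⟩
    g (b ∸ s)
      ≡⟨ *-identityˡ (g (b ∸ s)) ⟨
    1 * g (b ∸ s) ∎
    where
    head≡ : ∀ h → suc h + s ≡ b → suc h ≡ b ∸ s
    head≡ h eq = trans (sym (m+n∸n≡m (suc h) s)) (cong (_∸ s) eq)
    sum≡ : ∀ h → suc h ≡ b ∸ s → suc h + s ≡ b
    sum≡ h eq = trans (cong (_+ s) eq) (m∸n+n≡m (<⇒≤ s<b))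
  by-cases (no s≮b) =
    ∑-zero (λ h → cong (_* g (suc h)) (if-no (suc h + s ≟ b) (s≮b ∘ s<b h))) (upTo b)
    where
    s<b : ∀ h → suc h + s ≡ b → s < b
    s<b h eq = subst (s <_) eq (m<n+m s (s≤s z≤n))

wordsUpTo : ℕ → List (List ℕ)
wordsUpTo b = concatMap (listsOfLen b) (upTo (suc b))

∑-wordsUpTo-χ≡ : ∀ b v → All (1 ≤_) v → sum v ≤ b → ∑[ t ∈ wordsUpTo b ] χ (t ≡? v) ≡ 1
∑-wordsUpTo-χ≡ b v v>0 Σv≤b = begin
  ∑[ t ∈ wordsUpTo b ] χ (t ≡? v)
    ≡⟨ ∑-concatMap (λ t → χ (t ≡? v)) (listsOfLen b) (upTo (suc b)) ⟩
  ∑[ k < suc b ] ∑[ t ∈ listsOfLen b k ] χ (t ≡? v)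
    ≡⟨ ∑-cong (λ k → ∑-listsOfLen-χ≡ b k v v>0 v≤b) (upTo (suc b)) ⟩
  ∑[ k < suc b ] χ (k ≟ length v)
    ≡⟨ ∑-χ≟ (s≤s (≤-trans (length≤sum v>0) Σv≤b)) ⟩
  1 ∎
  where
  v≤b : All (_≤ b) v
  v≤b = All.map (λ y≤Σv → ≤-trans y≤Σv Σv≤b) (All-≤-sum v)

∑-wordsUpTo-dominatedSubseqs : ∀ b r → All (1 ≤_) r → sum r ≤ b →
  ∑[ t ∈ wordsUpTo b ] dominatedSubseqs t r ≡ product (map suc r)
∑-wordsUpTo-dominatedSubseqs b r r>0 Σr≤b = begin
  ∑[ t ∈ wordsUpTo b ] dominatedSubseqs t r
    ≡⟨ ∑-concatMap (λ t → dominatedSubseqs t r) (listsOfLen b) (upTo (suc b)) ⟩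
  ∑[ k < suc b ] ∑[ t ∈ listsOfLen b k ] dominatedSubseqs t r
    ≡⟨ ∑-cong (λ k → ∑-listsOfLen-dominatedSubseqs b k r r≤b) (upTo (suc b)) ⟩
  ∑[ k < suc b ] esym k r
    ≡⟨ ∑-esym r b (≤-trans (length≤sum r>0) Σr≤b) ⟩
  product (map suc r) ∎
  where
  r≤b : All (_≤ b) r
  r≤b = All.map (λ y≤Σr → ≤-trans y≤Σr Σr≤b) (All-≤-sum r)

∑-compositions : ∀ b → 0 < b → (f : List ℕ → ℕ) →
  ∑[ q ∈ compositions b ] f q ≡ ∑[ t ∈ wordsUpTo b ] χ (sum t <? b) * f (b ∸ sum t ∷ t)
∑-compositions b@(suc _) _ f = begin
  ∑[ q ∈ compositions b ] f q
    ≡⟨ ∑-filter (λ q → sum q ≟ b) f (wordsUpTo b) ⟩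
  ∑[ q ∈ wordsUpTo b ] F q
    ≡⟨ ∑-concatMap F (listsOfLen b) (upTo (suc b)) ⟩
  ∑[ k < suc b ] ∑[ q ∈ listsOfLen b k ] F q
    ≡⟨ ∑<-suc b (λ k → ∑[ q ∈ listsOfLen b k ] F q) ⟩
  ∑[ k < b ] ∑[ q ∈ listsOfLen b (suc k) ] F q
    ≡⟨ ∑-cong (λ k → ∑-listsOfLen-suc b k F) (upTo b) ⟩
  ∑[ k < b ] ∑[ h < b ] ∑[ t ∈ listsOfLen b k ] F (suc h ∷ t)
    ≡⟨ ∑-cong (λ k → ∑-comm (λ h t → F (suc h ∷ t)) (upTo b) (listsOfLen b k)) (upTo b) ⟩
  ∑[ k < b ] ∑[ t ∈ listsOfLen b k ] ∑[ h < b ] F (suc h ∷ t)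
    ≡⟨ ∑-cong (λ k → ∑-cong (λ t → ∑-χ-head b (sum t) (λ x → f (x ∷ t))) (listsOfLen b k)) (upTo b) ⟩
  ∑[ k < b ] S k
    ≡⟨ +-identityʳ _ ⟨
  ∑[ k < b ] S k + 0
    ≡⟨ cong (∑[ k < b ] S k +_) (∑-listsOfLen-sum<≡0 b b 0 b (λ t → f (b ∸ sum t ∷ t)) ≤-refl) ⟨
  ∑[ k < b ] S k + S b
    ≡⟨ ∑<-sucʳ b S ⟨
  ∑[ k < suc b ] S k
    ≡⟨ ∑-concatMap G (listsOfLen b) (upTo (suc b)) ⟨
  ∑[ t ∈ wordsUpTo b ] G t ∎
  where
  F G : List ℕ → ℕ
  F q = χ (sum q ≟ b) * f q
  G t = χ (sum t <? b) * f (b ∸ sum t ∷ t)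
  S : ℕ → ℕ
  S k = ∑[ t ∈ listsOfLen b k ] G t

A-by-tail : ∀ {b x rs} → IsComposition b (x ∷ rs) → ∀ t →
  χ (sum t <? b) * A (b ∸ sum t ∷ t) (x ∷ rs) + χ (t ≡? (x ∷ rs))
  ≡ dominatedSubseqs t (x ∷ rs) + χ (t ≡? rs)
A-by-tail {x = x} {rs} (r>0@(x>0 ∷ _) , refl) t = begin
  c * (D + I) + χ (t ≡? r)          ≡⟨ cong (_+ χ (t ≡? r)) (*-distribˡ-+ c D I) ⟩
  c * D + c * I + χ (t ≡? r)        ≡⟨ xy∙z≈xz∙y (c * D) (c * I) (χ (t ≡? r)) ⟩
  c * D + χ (t ≡? r) + c * I        ≡⟨ cong₂ _+_ (dominatedSubseqs-split t r r>0) head-determined ⟩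
  D + χ (t ≡? rs)                   ∎
  where
  r : List ℕ
  r = x ∷ rs
  c D I : ℕ
  c = χ (sum t <? sum r)
  D = dominatedSubseqs t r
  I = χ ((sum r ∸ sum t ∷ t) ≡? r)
  head-determined : c * I ≡ χ (t ≡? rs)
  head-determined = begin
    c * I
      ≡⟨ cong (c *_) (χ-cong ∷-injectiveʳ (λ { refl → cong (_∷ rs) (m+n∸n≡m x (sum rs)) })
                             ((sum r ∸ sum t ∷ t) ≡? r) (t ≡? rs)) ⟩
    c * χ (t ≡? rs)
      ≡⟨ χ-*-implied (λ { refl → m<n+m (sum rs) x>0 }) (sum t <? sum r) (t ≡? rs) ⟩
    χ (t ≡? rs) ∎

lemma2 : (b : ℕ) → 1 ≤ b → (r : List ℕ) → IsComposition b r →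
    sum (map (λ q → A q r) (compositions b)) ≡ product (map suc r)
lemma2 _ () [] (_ , refl)
lemma2 b b>0 r@(x ∷ rs) r∈C@(r>0@(_ ∷ rs>0) , Σr≡b) = +-cancelʳ-≡ 1 _ _ (begin
  ∑[ q ∈ compositions b ] A q r + 1
    ≡⟨ cong₂ _+_ (∑-compositions b b>0 (λ q → A q r)) (sym (∑-wordsUpTo-χ≡ b r r>0 Σr≤b)) ⟩
  ∑[ t ∈ W ] χ (sum t <? b) * A (b ∸ sum t ∷ t) r + ∑[ t ∈ W ] χ (t ≡? r)
    ≡⟨ ∑-distrib-+ (λ t → χ (sum t <? b) * A (b ∸ sum t ∷ t) r) (λ t → χ (t ≡? r)) W ⟨
  ∑[ t ∈ W ] (χ (sum t <? b) * A (b ∸ sum t ∷ t) r + χ (t ≡? r))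
    ≡⟨ ∑-cong (A-by-tail r∈C) W ⟩
  ∑[ t ∈ W ] (dominatedSubseqs t r + χ (t ≡? rs))
    ≡⟨ ∑-distrib-+ (λ t → dominatedSubseqs t r) (λ t → χ (t ≡? rs)) W ⟩
  ∑[ t ∈ W ] dominatedSubseqs t r + ∑[ t ∈ W ] χ (t ≡? rs)
    ≡⟨ cong₂ _+_ (∑-wordsUpTo-dominatedSubseqs b r r>0 Σr≤b) (∑-wordsUpTo-χ≡ b rs rs>0 Σrs≤b) ⟩
  product (map suc r) + 1 ∎)
  where
  W : List (List ℕ)
  W = wordsUpTo b
  Σr≤b : sum r ≤ b
  Σr≤b = ≤-reflexive Σr≡b
  Σrs≤b : sum rs ≤ b
  Σrs≤b = ≤-trans (m≤n+m (sum rs) x) Σr≤b
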